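{- Let $p$ be a prime, $n\geq 1$ and $k\geq 1$ integers, and $q$ an integer with $\gcd(q,p)=1$. Define $f:\{0,1,\dots,p^n-1\}\to\{0,1,\dots,p^n-1\}$ by $f(x)\equiv q^x \pmod{p^n}$, $0\le f(x)<p^n$. Then the number of $k$-periodic points of $f$, i.e. of $x\in\{0,\dots,p^n-1\}$ with $f^{k}(x)=x$ ($f^k$ the $k$-fold iterate), is at most $(p-1)^k$.
   Context: The paper assumes throughout that $\gcd(q,p)=1$. -}

module Defs where

open import Data.Nat using (ℕ; zero; suc; NonZero)
open import Data.Integer using (ℤ; +_)
import Data.Integer as ℤ
open import Data.Integer.DivMod using (_%_)
open import Data.List using (List; length; filter; upTo)
open import Data.Nat.Properties using (_≟_)

iter : {A : Set} → (A → A) → ℕ → A → A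
iter f zero    x = x
iter f (suc k) x = f (iter f k x)

expMod : (q : ℤ) (m : ℕ) .{{_ : NonZero m}} → ℕ → ℕ
expMod q m x = (q ℤ.^ x) % (+ m)

numPeriodic : (g : ℕ → ℕ) (N k : ℕ) → ℕ
numPeriodic g N k = length (filter (λ x → iter g k x ≟ x) (upTo N))

{-# OPTIONS --safe #-}
-- Choose 0 < e < p with q^e ≡ 1 (mod p), by pigeonhole on the nonzero residues of the powers
-- of q. Lifting gives q^(e p^j) ≡ 1 (mod p^(j+1)), and since gcd(e, p) = 1, a ≡ b modulo both
-- e and p^j forces f a ≡ f b (mod p^(j+1)). So if two k-periodic points have orbits with the
-- same residues mod e, induction on j shows that the orbits agree mod p^j for all j ≤ n, and the
-- points coincide. A k-periodic point is thus determined by k residues mod e, and there are at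
-- most e^k ≤ (p-1)^k of them.
module Submission where

open import Defs
open import Data.Nat using (ℕ; _^_; _≤_; _≥_; _∸_; NonZero)
open import Data.Nat.Properties using (m^n≢0)
open import Data.Nat.Primality using (Prime; prime⇒nonZero)
open import Data.Nat.Coprimality using (Coprime)
open import Data.Integer using (ℤ; ∣_∣)

open import Data.Nat as ℕ using (zero; suc; _<_; >-nonZero)
import Data.Nat.Properties as ℕ
open import Data.Nat.DivMod using (_%_; _/_; m≡m%n+[m/n]*n; m<n⇒m%n≡m; %-congˡ; %-remove-+ʳ)
import Data.Nat.DivMod as ℕ

open import Data.Nat.Divisibility as ℕ∣ using () renaming (_∣_ to _∣ℕ_)
open import Data.Nat.Coprimality as Coprime using (prime⇒coprime; coprime-divisor; coprime-factors; coprime⇒gcd≡1; 1-coprimeTo)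
open import Data.Nat.GCD using (gcd)
open import Data.Nat.LCM using (lcm; lcm-least; gcd*lcm)
open import Data.Nat.Primality using (¬prime[1])
open import Data.Integer as ℤ using (+_; 0ℤ; 1ℤ; _+_; _*_; _-_; -_)
import Data.Integer.Properties as ℤ
import Data.Integer.DivMod as ℤ
open import Data.Integer.Divisibility.Signed as ℤ∣ using (_∣_; divides; ∣ᵤ⇒∣; ∣⇒∣ᵤ)
import Data.Integer.Solver as IntegerSolver
open IntegerSolver.+-*-Solver using (solve; _:=_; _:+_; _:*_; _:-_; :-_; con)
open import Data.Fin as Fin using (Fin; toℕ; fromℕ<; combine)
open import Data.Fin.Properties using (pigeonhole; injective⇒≤; combine-injective; toℕ-fromℕ<; toℕ<n)
open import Data.List using (List; length; lookup; filter; upTo)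
open import Data.List.Membership.Propositional using (_∈_)
open import Data.List.Membership.Propositional.Properties using (∈-lookup; ∈-filter⁻; ∈-upTo⁻)
open import Data.List.Relation.Unary.Unique.Propositional using (Unique; _∷_)
import Data.List.Relation.Unary.Unique.Propositional.Properties as Unique
import Data.List.Relation.Unary.All as All
open import Data.Empty using (⊥-elim)
open import Data.Product using (∃-syntax; _×_; _,_)
open import Data.Sum using (inj₁; inj₂)
open import Relation.Binary.PropositionalEquality
open import Relation.Nullary using (¬_)

coprime-* : ∀ {m n o} → Coprime m n → Coprime m o → Coprime m (n ℕ.* o)
coprime-* {m} {n} {o} m⊥n m⊥o (i∣m , i∣n*o) =
  m⊥o (i∣m , coprime-factors m⊥n (ℕ∣.∣-trans i∣m (ℕ∣.m∣m*n o) , i∣n*o))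

coprime-^ : ∀ {m n} → Coprime m n → ∀ i → Coprime m (n ^ i)
coprime-^ {m} m⊥n zero    = Coprime.sym (1-coprimeTo m)
coprime-^     m⊥n (suc i) = coprime-* m⊥n (coprime-^ m⊥n i)

coprime⇒lcm≡* : ∀ {m n} → Coprime m n → lcm m n ≡ m ℕ.* n
coprime⇒lcm≡* {m} {n} m⊥n = begin
  lcm m n              ≡⟨ ℕ.*-identityˡ (lcm m n) ⟨
  1 ℕ.* lcm m n        ≡⟨ cong (ℕ._* lcm m n) (coprime⇒gcd≡1 m⊥n) ⟨
  gcd m n ℕ.* lcm m n  ≡⟨ gcd*lcm m n ⟩
  m ℕ.* n              ∎
  where open ≡-Reasoning

coprime⇒*∣ : ∀ {m n o} → Coprime m n → m ∣ℕ o → n ∣ℕ o → m ℕ.* n ∣ℕ o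
coprime⇒*∣ m⊥n m∣o n∣o = subst (_∣ℕ _) (coprime⇒lcm≡* m⊥n) (lcm-least m∣o n∣o)

^-monoʳ-∣ : ∀ m {i j} → i ≤ j → m ^ i ∣ℕ m ^ j
^-monoʳ-∣ m {j = j} ℕ.z≤n       = ℕ∣.1∣ (m ^ j)
^-monoʳ-∣ m         (ℕ.s≤s i≤j) = ℕ∣.*-monoʳ-∣ m (^-monoʳ-∣ m i≤j)

infix 4 _≡_mod_

record _≡_mod_ (a b : ℤ) (m : ℕ) : Set where
  constructor congruent
  field
    m∣a-b : + m ∣ a - b

module _ {m : ℕ} where

  ≡mod-refl : ∀ {a} → a ≡ a mod m
  ≡mod-refl {a} = congruent (subst (+ m ∣_) (sym (ℤ.+-inverseʳ a)) (divides 0ℤ refl))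

  ≡mod-sym : ∀ {a b} → a ≡ b mod m → b ≡ a mod m
  ≡mod-sym {a} {b} (congruent m∣a-b) = congruent (subst (+ m ∣_) (-[a-b]≡b-a a b) (ℤ∣.∣m⇒∣-m m∣a-b))
    where
    -[a-b]≡b-a : ∀ a b → - (a - b) ≡ b - a
    -[a-b]≡b-a = solve 2 (λ a b → :- (a :- b) := b :- a) refl

  ≡mod-trans : ∀ {a b c} → a ≡ b mod m → b ≡ c mod m → a ≡ c mod m
  ≡mod-trans {a} {b} {c} (congruent m∣a-b) (congruent m∣b-c) =
    congruent (subst (+ m ∣_) (ℤ.+-minus-telescope a b c) (ℤ∣.∣m∣n⇒∣m+n m∣a-b m∣b-c))

  ≡mod-+ : ∀ {a b c d} → a ≡ b mod m → c ≡ d mod m → a + c ≡ b + d mod m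
  ≡mod-+ {a} {b} {c} {d} (congruent m∣a-b) (congruent m∣c-d) =
    congruent (subst (+ m ∣_) (regroup a b c d) (ℤ∣.∣m∣n⇒∣m+n m∣a-b m∣c-d))
    where
    regroup : ∀ a b c d → (a - b) + (c - d) ≡ (a + c) - (b + d)
    regroup = solve 4 (λ a b c d → (a :- b) :+ (c :- d) := (a :+ c) :- (b :+ d)) refl

  ≡mod-* : ∀ {a b c d} → a ≡ b mod m → c ≡ d mod m → a * c ≡ b * d mod m
  ≡mod-* {a} {b} {c} {d} (congruent m∣a-b) (congruent m∣c-d) =
    congruent (subst (+ m ∣_) (sym (split a b c d)) (ℤ∣.∣m∣n⇒∣m+n (ℤ∣.∣m⇒∣m*n c m∣a-b) (ℤ∣.∣n⇒∣m*n b m∣c-d)))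
    where
    split : ∀ a b c d → a * c - b * d ≡ (a - b) * c + b * (c - d)
    split = solve 4 (λ a b c d → a :* c :- b :* d := (a :- b) :* c :+ b :* (c :- d)) refl

  ≡mod-^ : ∀ {a b} → a ≡ b mod m → ∀ i → a ℤ.^ i ≡ b ℤ.^ i mod m
  ≡mod-^ a≡b zero    = ≡mod-refl
  ≡mod-^ a≡b (suc i) = ≡mod-* a≡b (≡mod-^ a≡b i)

  ≡mod-∣ : ∀ {a b} → a ≡ b mod m → + m ∣ b → + m ∣ a
  ≡mod-∣ (congruent m∣a-b) m∣b = ℤ∣.∣m+n∣n⇒∣m m∣a-b (ℤ∣.∣m⇒∣-m m∣b)

  ≡mod-cancelˡ : ∀ c {a b} → Coprime m ∣ c ∣ → c * a ≡ c * b mod m → a ≡ b mod m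
  ≡mod-cancelˡ c {a} {b} m⊥c (congruent m∣ca-cb) = congruent (∣ᵤ⇒∣ (coprime-divisor m⊥c m∣∣c∣*∣a-b∣))
    where
    factor : ∀ c a b → c * a - c * b ≡ c * (a - b)
    factor = solve 3 (λ c a b → c :* a :- c :* b := c :* (a :- b)) refl
    m∣∣c∣*∣a-b∣ : m ∣ℕ ∣ c ∣ ℕ.* ∣ a - b ∣
    m∣∣c∣*∣a-b∣ = subst (m ∣ℕ_) (trans (cong ∣_∣ (factor c a b)) (ℤ.abs-* c (a - b))) (∣⇒∣ᵤ m∣ca-cb)

≡mod-divisor : ∀ {d m a b} → d ∣ℕ m → a ≡ b mod m → a ≡ b mod d
≡mod-divisor d∣m (congruent m∣a-b) = congruent (ℤ∣.∣-trans (∣ᵤ⇒∣ d∣m) m∣a-b)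

≡mod-coprime : ∀ {m n a b} → Coprime m n → a ≡ b mod m → a ≡ b mod n → a ≡ b mod m ℕ.* n
≡mod-coprime m⊥n (congruent m∣a-b) (congruent n∣a-b) = congruent (∣ᵤ⇒∣ (coprime⇒*∣ m⊥n (∣⇒∣ᵤ m∣a-b) (∣⇒∣ᵤ n∣a-b)))

%-≡mod : ∀ z m .{{_ : NonZero m}} → + (z ℤ.% + m) ≡ z mod m
%-≡mod z m = congruent (divides (- (z ℤ./ + m)) (begin
  + r - z                      ≡⟨ cong (λ w → + r - w) (ℤ.a≡a%n+[a/n]*n z (+ m)) ⟩
  + r - (+ r + z ℤ./ + m * + m) ≡⟨ cancel (+ r) (z ℤ./ + m) (+ m) ⟩
  - (z ℤ./ + m) * + m          ∎))
  where
  open ≡-Reasoning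
  r = z ℤ.% + m
  cancel : ∀ r d m → r - (r + d * m) ≡ (- d) * m
  cancel = solve 3 (λ r d m → r :- (r :+ d :* m) := (:- d) :* m) refl

%≡%⇒≡mod : ∀ {m a b} .{{_ : NonZero m}} → a % m ≡ b % m → + a ≡ + b mod m
%≡%⇒≡mod {m} {a} {b} a%m≡b%m = ≡mod-trans (≡mod-sym (%-≡mod (+ a) m))
  (subst (λ r → + r ≡ + b mod m) (sym a%m≡b%m) (%-≡mod (+ b) m))

≡mod⇒%≡%-≥ : ∀ {m a b} .{{_ : NonZero m}} → b ≤ a → + a ≡ + b mod m → a % m ≡ b % m
≡mod⇒%≡%-≥ {m} {a} {b} b≤a (congruent m∣a-b) = begin
  a % m               ≡⟨ %-congˡ (ℕ.m+[n∸m]≡n b≤a) ⟨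
  (b ℕ.+ (a ∸ b)) % m ≡⟨ %-remove-+ʳ b (subst (m ∣ℕ_) ∣a-b∣≡a∸b (∣⇒∣ᵤ m∣a-b)) ⟩
  b % m               ∎
  where
  open ≡-Reasoning
  ∣a-b∣≡a∸b : ∣ + a - + b ∣ ≡ a ∸ b
  ∣a-b∣≡a∸b = cong ∣_∣ (trans (ℤ.[+m]-[+n]≡m⊖n a b) (ℤ.⊖-≥ b≤a))

≡mod⇒%≡% : ∀ {m a b} .{{_ : NonZero m}} → + a ≡ + b mod m → a % m ≡ b % m
≡mod⇒%≡% {m} {a} {b} a≡b with ℕ.≤-total b a
... | inj₁ b≤a = ≡mod⇒%≡%-≥ b≤a a≡b
... | inj₂ a≤b = sym (≡mod⇒%≡%-≥ a≤b (≡mod-sym a≡b))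

≡mod∧<⇒≡ : ∀ {m x y} → + x ≡ + y mod m → x < m → y < m → x ≡ y
≡mod∧<⇒≡ {m} {x} {y} x≡y x<m y<m = begin
  x     ≡⟨ m<n⇒m%n≡m x<m ⟨
  x % m ≡⟨ ≡mod⇒%≡% x≡y ⟩
  y % m ≡⟨ m<n⇒m%n≡m y<m ⟩
  y     ∎
  where
  instance _ = >-nonZero (ℕ.≤-<-trans ℕ.z≤n x<m)
  open ≡-Reasoning

geometricSum : ℤ → ℕ → ℤ
geometricSum a zero    = 0ℤ
geometricSum a (suc i) = 1ℤ + a * geometricSum a i

^-1≡[a-1]*geometricSum : ∀ a i → a ℤ.^ i - 1ℤ ≡ (a - 1ℤ) * geometricSum a i
^-1≡[a-1]*geometricSum a zero    = sym (ℤ.*-zeroʳ (a - 1ℤ))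
^-1≡[a-1]*geometricSum a (suc i) = begin
  a * a ℤ.^ i - 1ℤ                     ≡⟨ peel a (a ℤ.^ i) ⟩
  a * (a ℤ.^ i - 1ℤ) + (a - 1ℤ)        ≡⟨ cong (λ z → a * z + (a - 1ℤ)) (^-1≡[a-1]*geometricSum a i) ⟩
  a * ((a - 1ℤ) * g) + (a - 1ℤ)        ≡⟨ collect a g ⟩
  (a - 1ℤ) * (1ℤ + a * g)              ∎
  where
  open ≡-Reasoning
  g = geometricSum a i
  peel : ∀ a x → a * x - 1ℤ ≡ a * (x - 1ℤ) + (a - 1ℤ)
  peel = solve 2 (λ a x → a :* x :- con 1ℤ := a :* (x :- con 1ℤ) :+ (a :- con 1ℤ)) refl
  collect : ∀ a g → a * ((a - 1ℤ) * g) + (a - 1ℤ) ≡ (a - 1ℤ) * (1ℤ + a * g)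
  collect = solve 2 (λ a g → a :* ((a :- con 1ℤ) :* g) :+ (a :- con 1ℤ) := (a :- con 1ℤ) :* (con 1ℤ :+ a :* g)) refl

geometricSum-≡mod : ∀ {m a} → a ≡ 1ℤ mod m → ∀ i → geometricSum a i ≡ + i mod m
geometricSum-≡mod a≡1 zero    = ≡mod-refl
geometricSum-≡mod {m} {a} a≡1 (suc i) =
  subst (λ z → 1ℤ + a * geometricSum a i ≡ 1ℤ + z mod m) (ℤ.*-identityˡ (+ i))
    (≡mod-+ (≡mod-refl {a = 1ℤ}) (≡mod-* a≡1 (geometricSum-≡mod a≡1 i)))

-- a^p - 1 = (a - 1)(1 + a + ⋯ + a^(p-1)), and the second factor is ≡ p ≡ 0 mod p as a ≡ 1 mod p.
^-lift : ∀ {a m} p → a ≡ 1ℤ mod m → p ∣ℕ m → a ℤ.^ p ≡ 1ℤ mod m ℕ.* p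
^-lift {a} {m} p a≡1@(congruent m∣a-1) p∣m =
  congruent (subst₂ _∣_ (sym (ℤ.pos-* m p)) (sym (^-1≡[a-1]*geometricSum a p))
    (ℤ∣.∣-trans (ℤ∣.*-monoʳ-∣ (+ m) p∣sum) (ℤ∣.*-monoˡ-∣ (geometricSum a p) m∣a-1)))
  where
  p∣sum : + p ∣ geometricSum a p
  p∣sum = ≡mod-∣ (geometricSum-≡mod (≡mod-divisor p∣m a≡1) p) ℤ∣.∣-refl

^[p^j]≡1 : ∀ {a p} → a ≡ 1ℤ mod p → ∀ j → a ℤ.^ (p ^ j) ≡ 1ℤ mod p ^ suc j
^[p^j]≡1 {a} {p} a≡1 zero = subst₂ (λ x m → x ≡ 1ℤ mod m) (sym (ℤ.^-identityʳ a)) (sym (ℕ.*-identityʳ p)) a≡1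
^[p^j]≡1 {a} {p} a≡1 (suc j) = subst₂ (λ x m → x ≡ 1ℤ mod m)
  (trans (ℤ.^-*-assoc a (p ^ j) p) (cong (a ℤ.^_) (ℕ.*-comm (p ^ j) p)))
  (ℕ.*-comm (p ^ suc j) p)
  (^-lift p (^[p^j]≡1 a≡1 j) (ℕ∣.m∣m*n (p ^ j)))

^-≡mod-% : ∀ {q m d} .{{_ : NonZero d}} → q ℤ.^ d ≡ 1ℤ mod m → ∀ a → q ℤ.^ a ≡ q ℤ.^ (a % d) mod m
^-≡mod-% {q} {m} {d} q^d≡1 a = subst₂ (λ x y → x ≡ y mod m) split (ℤ.*-identityʳ (q ℤ.^ (a % d)))
  (≡mod-* (≡mod-refl {a = q ℤ.^ (a % d)}) [q^d]^[a/d]≡1)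
  where
  [q^d]^[a/d]≡1 : (q ℤ.^ d) ℤ.^ (a / d) ≡ 1ℤ mod m
  [q^d]^[a/d]≡1 = subst (λ y → (q ℤ.^ d) ℤ.^ (a / d) ≡ y mod m) (ℤ.^-zeroˡ (a / d)) (≡mod-^ q^d≡1 (a / d))
  split : q ℤ.^ (a % d) * (q ℤ.^ d) ℤ.^ (a / d) ≡ q ℤ.^ a
  split = begin
    q ℤ.^ (a % d) * (q ℤ.^ d) ℤ.^ (a / d)   ≡⟨ cong (q ℤ.^ (a % d) *_) (ℤ.^-*-assoc q d (a / d)) ⟩
    q ℤ.^ (a % d) * q ℤ.^ (d ℕ.* (a / d))   ≡⟨ ℤ.^-distribˡ-+-* q (a % d) _ ⟨
    q ℤ.^ (a % d ℕ.+ d ℕ.* (a / d))         ≡⟨ cong (λ k → q ℤ.^ (a % d ℕ.+ k)) (ℕ.*-comm d (a / d)) ⟩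
    q ℤ.^ (a % d ℕ.+ a / d ℕ.* d)           ≡⟨ cong (q ℤ.^_) (m≡m%n+[m/n]*n a d) ⟨
    q ℤ.^ a                                 ∎
    where open ≡-Reasoning

^-≡mod : ∀ {q m d a b} .{{_ : NonZero d}} → q ℤ.^ d ≡ 1ℤ mod m → a % d ≡ b % d → q ℤ.^ a ≡ q ℤ.^ b mod m
^-≡mod {q} {m} {a = a} {b} q^d≡1 a%d≡b%d = ≡mod-trans (^-≡mod-% q^d≡1 a)
  (subst (λ r → q ℤ.^ r ≡ q ℤ.^ b mod m) (sym a%d≡b%d) (≡mod-sym (^-≡mod-% q^d≡1 b)))

∣i^n∣≡∣i∣^n : ∀ i n → ∣ i ℤ.^ n ∣ ≡ ∣ i ∣ ^ n
∣i^n∣≡∣i∣^n i zero    = refl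
∣i^n∣≡∣i∣^n i (suc n) = trans (ℤ.abs-* i (i ℤ.^ n)) (cong (∣ i ∣ ℕ.*_) (∣i^n∣≡∣i∣^n i n))

module _ {p : ℕ} {q : ℤ} (p-prime : Prime p) (q⊥p : Coprime ∣ q ∣ p) where

  private instance
    p≢0 : NonZero p
    p≢0 = prime⇒nonZero p-prime

  p⊥q^i : ∀ i → Coprime p ∣ q ℤ.^ i ∣
  p⊥q^i i = subst (Coprime p) (sym (∣i^n∣≡∣i∣^n q i)) (coprime-^ (Coprime.sym q⊥p) i)

  q^i≢0 : ∀ i → ¬ (q ℤ.^ i ≡ 0ℤ mod p)
  q^i≢0 i q^i≡0 = ¬prime[1] (subst Prime (ℕ∣.∣1⇒≡1 (∣⇒∣ᵤ p∣1)) p-prime)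
    where
    1≡0 : 1ℤ ≡ 0ℤ mod p
    1≡0 = ≡mod-cancelˡ (q ℤ.^ i) (p⊥q^i i)
      (subst₂ (λ x y → x ≡ y mod p) (sym (ℤ.*-identityʳ (q ℤ.^ i))) (sym (ℤ.*-zeroʳ (q ℤ.^ i))) q^i≡0)
    p∣1 : + p ∣ 1ℤ
    p∣1 = ≡mod-∣ 1≡0 (divides 0ℤ refl)

  residue : ℕ → ℕ
  residue i = q ℤ.^ i ℤ.% + p

  residue-nonZero : ∀ i → NonZero (residue i)
  residue-nonZero i = ℕ.≢-nonZero λ rᵢ≡0 →
    q^i≢0 i (≡mod-sym (subst (λ r → + r ≡ q ℤ.^ i mod p) rᵢ≡0 (%-≡mod (q ℤ.^ i) p)))

  nonzeroResidue : Fin p → Fin (ℕ.pred p)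
  nonzeroResidue k = fromℕ< (ℕ.pred-mono-< {{residue-nonZero (toℕ k)}} (ℤ.n%d<d (q ℤ.^ toℕ k) (+ p)))

  pred[p]<p : ℕ.pred p < p
  pred[p]<p = ℕ.m≤pred[n]⇒suc[m]≤n ℕ.≤-refl

  collision⇒q^[j-i]≡1 : ∀ {i j} → i Fin.< j → nonzeroResidue i ≡ nonzeroResidue j →
                        q ℤ.^ (toℕ j ∸ toℕ i) ≡ 1ℤ mod p
  collision⇒q^[j-i]≡1 {i} {j} i<j same = ≡mod-cancelˡ (q ℤ.^ toℕ i) (p⊥q^i (toℕ i))
    (subst₂ (λ x y → x ≡ y mod p) q^j≡q^i*q^e (sym (ℤ.*-identityʳ (q ℤ.^ toℕ i))) q^j≡q^i)
    where
    e = toℕ j ∸ toℕ i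
    rᵢ≡rⱼ : residue (toℕ i) ≡ residue (toℕ j)
    rᵢ≡rⱼ = ℕ.pred-injective {{residue-nonZero (toℕ i)}} {{residue-nonZero (toℕ j)}}
      (trans (sym (toℕ-fromℕ< _)) (trans (cong toℕ same) (toℕ-fromℕ< _)))
    q^j≡q^i : q ℤ.^ toℕ j ≡ q ℤ.^ toℕ i mod p
    q^j≡q^i = ≡mod-trans (≡mod-sym (%-≡mod (q ℤ.^ toℕ j) p))
      (subst (λ r → + r ≡ q ℤ.^ toℕ i mod p) rᵢ≡rⱼ (%-≡mod (q ℤ.^ toℕ i) p))
    q^j≡q^i*q^e : q ℤ.^ toℕ j ≡ q ℤ.^ toℕ i * q ℤ.^ e
    q^j≡q^i*q^e = trans (cong (q ℤ.^_) (sym (ℕ.m+[n∸m]≡n (ℕ.<⇒≤ i<j)))) (ℤ.^-distribˡ-+-* q (toℕ i) e)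

  -- The p powers q⁰, …, q^(p-1) have only p - 1 possible (nonzero) residues.
  power≡1-exists : ∃[ e ] 0 < e × e < p × q ℤ.^ e ≡ 1ℤ mod p
  power≡1-exists =
    let i , j , i<j , same = pigeonhole pred[p]<p nonzeroResidue
    in  toℕ j ∸ toℕ i , ℕ.m<n⇒0<n∸m i<j , ℕ.≤-<-trans (ℕ.m∸n≤m (toℕ j) (toℕ i)) (toℕ<n j) ,
        collision⇒q^[j-i]≡1 i<j same

module _ {A : Set} (f : A → A) where

  iter-+ : ∀ m n x → iter f (m ℕ.+ n) x ≡ iter f m (iter f n x)
  iter-+ zero    n x = refl
  iter-+ (suc m) n x = cong f (iter-+ m n x)

  iter-*-period : ∀ {k x} → iter f k x ≡ x → ∀ t → iter f (t ℕ.* k) x ≡ x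
  iter-*-period          fᵏx≡x zero    = refl
  iter-*-period {k} {x} fᵏx≡x (suc t) = begin
    iter f (k ℕ.+ t ℕ.* k) x     ≡⟨ iter-+ k (t ℕ.* k) x ⟩
    iter f k (iter f (t ℕ.* k) x) ≡⟨ cong (iter f k) (iter-*-period fᵏx≡x t) ⟩
    iter f k x                   ≡⟨ fᵏx≡x ⟩
    x                            ∎
    where open ≡-Reasoning

  iter-% : ∀ {k x} .{{_ : NonZero k}} → iter f k x ≡ x → ∀ i → iter f i x ≡ iter f (i % k) x
  iter-% {k} {x} fᵏx≡x i = begin
    iter f i x                               ≡⟨ cong (λ m → iter f m x) (m≡m%n+[m/n]*n i k) ⟩
    iter f (i % k ℕ.+ i / k ℕ.* k) x         ≡⟨ iter-+ (i % k) (i / k ℕ.* k) x ⟩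
    iter f (i % k) (iter f (i / k ℕ.* k) x)  ≡⟨ cong (iter f (i % k)) (iter-*-period fᵏx≡x (i / k)) ⟩
    iter f (i % k) x                         ∎
    where open ≡-Reasoning

lookup-injective : ∀ {A : Set} {xs : List A} → Unique xs → ∀ {i j} → lookup xs i ≡ lookup xs j → i ≡ j
lookup-injective (_     ∷ _) {Fin.zero}  {Fin.zero}  _      = refl
lookup-injective (x∉xs ∷ _) {Fin.zero}  {Fin.suc j} x≡xⱼ  = ⊥-elim (All.lookup x∉xs (∈-lookup j) x≡xⱼ)
lookup-injective (x∉xs ∷ _) {Fin.suc i} {Fin.zero}  xᵢ≡x  = ⊥-elim (All.lookup x∉xs (∈-lookup i) (sym xᵢ≡x))
lookup-injective (_     ∷ u) {Fin.suc i} {Fin.suc j} xᵢ≡xⱼ = cong Fin.suc (lookup-injective u xᵢ≡xⱼ)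

unique⇒length≤ : ∀ {A : Set} {xs : List A} {B} (c : A → Fin B) → Unique xs →
                 (∀ {x y} → x ∈ xs → y ∈ xs → c x ≡ c y → x ≡ y) → length xs ≤ B
unique⇒length≤ c u c-injective =
  injective⇒≤ λ cᵢ≡cⱼ → lookup-injective u (c-injective (∈-lookup _) (∈-lookup _) cᵢ≡cⱼ)

module _ (f : ℕ → ℕ) (e : ℕ) .{{_ : NonZero e}} where

  -- The residues mod e of x, f x, …, f^(k-1) x, as the digits of a number below e^k.
  residueCode : ∀ k → ℕ → Fin (e ^ k)
  residueCode zero    x = Fin.zero
  residueCode (suc k) x = combine (iter f k x ℕ.mod e) (residueCode k x)

  residueCode-injective : ∀ {k x y} → residueCode k x ≡ residueCode k y →
                          ∀ {i} → i < k → iter f i x % e ≡ iter f i y % e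
  residueCode-injective {suc k} {x} {y} codes≡ {i} i<1+k
    with combine-injective (iter f k x ℕ.mod e) (residueCode k x) (iter f k y ℕ.mod e) (residueCode k y) codes≡
       | ℕ.m<1+n⇒m<n∨m≡n i<1+k
  ... | _ , rest≡ | inj₁ i<k  = residueCode-injective rest≡ i<k
  ... | last≡ , _ | inj₂ refl = trans (sym (toℕ-fromℕ< _)) (trans (cong toℕ last≡) (toℕ-fromℕ< _))

module PeriodicPoints (q : ℤ) (p n e : ℕ) .{{_ : NonZero p}} .{{_ : NonZero e}}
                      (e⊥p : Coprime e p) (q^e≡1 : q ℤ.^ e ≡ 1ℤ mod p) where

  N : ℕ
  N = p ^ n

  instance
    N≢0 : NonZero N
    N≢0 = m^n≢0 p n

  f : ℕ → ℕ
  f = expMod q N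

  q^[e*p^j]≡1 : ∀ j → q ℤ.^ (e ℕ.* p ^ j) ≡ 1ℤ mod p ^ suc j
  q^[e*p^j]≡1 j = subst (λ x → x ≡ 1ℤ mod p ^ suc j) (ℤ.^-*-assoc q e (p ^ j)) (^[p^j]≡1 q^e≡1 j)

  f-≡mod : ∀ {j a b} → j < n → + a ≡ + b mod p ^ j → a % e ≡ b % e → + f a ≡ + f b mod p ^ suc j
  f-≡mod {j} {a} {b} j<n a≡b a%e≡b%e =
    ≡mod-trans (≡mod-divisor p^[1+j]∣N (%-≡mod (q ℤ.^ a) N))
      (≡mod-trans q^a≡q^b (≡mod-sym (≡mod-divisor p^[1+j]∣N (%-≡mod (q ℤ.^ b) N))))
    where
    instance
      p^j≢0 : NonZero (p ^ j)
      p^j≢0 = m^n≢0 p j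
      e*p^j≢0 : NonZero (e ℕ.* p ^ j)
      e*p^j≢0 = ℕ.m*n≢0 e (p ^ j)
    p^[1+j]∣N : p ^ suc j ∣ℕ N
    p^[1+j]∣N = ^-monoʳ-∣ p j<n
    a≡b[mod-e*p^j] : + a ≡ + b mod e ℕ.* p ^ j
    a≡b[mod-e*p^j] = ≡mod-coprime (coprime-^ e⊥p j) (%≡%⇒≡mod a%e≡b%e) a≡b
    q^a≡q^b : q ℤ.^ a ≡ q ℤ.^ b mod p ^ suc j
    q^a≡q^b = ^-≡mod {q = q} {d = e ℕ.* p ^ j} (q^[e*p^j]≡1 j) (≡mod⇒%≡% a≡b[mod-e*p^j])

  module _ {k x y} (x-periodic : iter f (suc k) x ≡ x) (y-periodic : iter f (suc k) y ≡ y)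
           (same-residues : ∀ i → iter f i x % e ≡ iter f i y % e) where

    iterates-≡mod : ∀ {j} → j ≤ n → ∀ i → + iter f i x ≡ + iter f i y mod p ^ j
    iterates-≡mod {zero}  _     i       = congruent (∣ᵤ⇒∣ (ℕ∣.1∣ _))
    iterates-≡mod {suc j} j<n (suc i) = f-≡mod j<n (iterates-≡mod (ℕ.<⇒≤ j<n) i) (same-residues i)
    -- x = f^(k+1) x is itself a value of f, so the step applies at index 0 too.
    iterates-≡mod {suc j} j<n zero    = subst₂ (λ u v → + u ≡ + v mod p ^ suc j) x-periodic y-periodic
      (f-≡mod j<n (iterates-≡mod (ℕ.<⇒≤ j<n) k) (same-residues k))

    periodic-≡ : x < N → y < N → x ≡ y
    periodic-≡ = ≡mod∧<⇒≡ (iterates-≡mod ℕ.≤-refl 0)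

  numPeriodic≤ : ∀ k → numPeriodic f N (suc k) ≤ e ^ suc k
  numPeriodic≤ k =
    unique⇒length≤ (residueCode f e (suc k)) (Unique.filter⁺ periodic? (Unique.upTo⁺ N)) same-code⇒≡
    where
    periodic? = λ x → iter f (suc k) x ℕ.≟ x
    same-code⇒≡ : ∀ {x y} → x ∈ filter periodic? (upTo N) → y ∈ filter periodic? (upTo N) →
                  residueCode f e (suc k) x ≡ residueCode f e (suc k) y → x ≡ y
    same-code⇒≡ {x} {y} x∈ y∈ codes≡
      with ∈-filter⁻ periodic? {xs = upTo N} x∈ | ∈-filter⁻ periodic? {xs = upTo N} y∈
    ... | x<N , x-periodic | y<N , y-periodic =
      periodic-≡ {k = k} x-periodic y-periodic same-residues (∈-upTo⁻ x<N) (∈-upTo⁻ y<N)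
      where
      same-residues : ∀ i → iter f i x % e ≡ iter f i y % e
      same-residues i =
        subst₂ (λ u v → u % e ≡ v % e) (sym (iter-% f x-periodic i)) (sym (iter-% f y-periodic i))
          (residueCode-injective f e codes≡ (ℕ.m%n<n i (suc k)))

corollary2 : (p n k : ℕ) (q : ℤ) → (pp : Prime p) → n ≥ 1 → k ≥ 1 → Coprime ∣ q ∣ p →
    numPeriodic (expMod q (p ^ n) {{m^n≢0 p n {{prime⇒nonZero pp}}}}) (p ^ n) k ≤ (p ∸ 1) ^ k
corollary2 p n zero    q pp _ () _
corollary2 p n (suc k) q pp _ _ q⊥p =
  let e , 0<e , e<p , q^e≡1 = power≡1-exists pp q⊥p
      e⊥p = Coprime.sym (prime⇒coprime pp {{>-nonZero 0<e}} e<p)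
  in  ℕ.≤-trans (PeriodicPoints.numPeriodic≤ q p n e {{prime⇒nonZero pp}} {{>-nonZero 0<e}} e⊥p q^e≡1 k)
                (ℕ.^-monoˡ-≤ (suc k) (ℕ.<⇒≤pred e<p))
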